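{- Let $G_1,G_2$ be finite groups and let $S_1\subseteq G_1$, $S_2\subseteq G_2$ be non-empty. Then \[ e(S_1,G_1)\,e(S_2,G_2)\le e(S_1\times S_2,G_1\times G_2)\le \min\{e(S_1,G_1),e(S_2,G_2)\}, \] equivalently \[ \kappa(S_1,G_1)\,\kappa(S_2,G_2)\ge \kappa(S_1\times S_2,G_1\times G_2)\ge \max\{\kappa(S_1,G_1),\kappa(S_2,G_2)\}. \]
   Context: For a finite group $G$ and non-empty $S\subseteq G$, $\tau(S,G)=\min\{|T|:T\subseteq G,\ TS=G\}$ where $TS=\{ts:t\in T,s\in S\}$; $\kappa(S,G)=\tau(S,G)|S|/|G|$ and $e(S,G)=1/\kappa(S,G)$. -}

module Defs where

open import Data.Nat as ℕ using (ℕ; suc; _*_; NonZero)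
open import Data.Integer using (+_)
open import Data.Rational as ℚ using (ℚ)
open import Data.Fin using (Fin; zero; suc; combine; remQuot; quotient; remainder)
open import Data.Fin.Properties using (remQuot-combine; combine-remQuot)
open import Data.Fin.Subset using (Subset; _∈_; ∣_∣)
open import Data.Bool using (_∧_)
open import Data.Vec using (tabulate; lookup)
open import Data.Product using (Σ; ∃; _×_; _,_; proj₁; proj₂)
open import Algebra.Structures using (IsGroup)
open import Relation.Binary.PropositionalEquality
  using (_≡_; refl; sym; trans; cong; cong₂; isEquivalence)

-- A finite group: a group structure on Fin order, equality being _≡_.
-- (Every finite group is isomorphic to one of these.)
record FinGroup : Set where
  field
    order   : ℕ
    _·_     : Fin order → Fin order → Fin order
    ε       : Fin order
    _⁻¹     : Fin order → Fin order
    isGroup : IsGroup _≡_ _·_ ε _⁻¹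

open FinGroup public

order-nonZero : (G : FinGroup) → NonZero (order G)
order-nonZero G with order G | ε G
... | suc _ | _ = _

Covers : (G : FinGroup) → Subset (order G) → Subset (order G) → Set
Covers G T S = ∀ g → ∃ λ t → ∃ λ s → t ∈ T × s ∈ S × g ≡ _·_ G t s

IsTau : (G : FinGroup) → Subset (order G) → ℕ → Set
IsTau G S τ =
  (∃ λ T → Covers G T S × ∣ T ∣ ≡ τ) ×
  (∀ T → Covers G T S → τ ℕ.≤ ∣ T ∣)

κ : (G : FinGroup) → Subset (order G) → ℕ → ℚ
κ G S τ = ℚ._/_ (+ (τ * ∣ S ∣)) (order G) {{order-nonZero G}}

module _ (G₁ G₂ : FinGroup) where
  private
    n₁ = order G₁
    n₂ = order G₂
    module G₁ = IsGroup (isGroup G₁)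
    module G₂ = IsGroup (isGroup G₂)
    q : Fin (n₁ * n₂) → Fin n₁
    q = quotient {n₁} n₂
    r : Fin (n₁ * n₂) → Fin n₂
    r = remainder {n₁} n₂
    qc : ∀ a b → q (combine a b) ≡ a
    qc a b = cong proj₁ (remQuot-combine {n₁} {n₂} a b)
    rc : ∀ a b → r (combine a b) ≡ b
    rc a b = cong proj₂ (remQuot-combine {n₁} {n₂} a b)
    cqr : ∀ x → combine (q x) (r x) ≡ x
    cqr x = combine-remQuot {n₁} n₂ x

    mul : Fin (n₁ * n₂) → Fin (n₁ * n₂) → Fin (n₁ * n₂)
    mul x y = combine (_·_ G₁ (q x) (q y)) (_·_ G₂ (r x) (r y))
    e : Fin (n₁ * n₂)
    e = combine (ε G₁) (ε G₂)
    inv : Fin (n₁ * n₂) → Fin (n₁ * n₂)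
    inv x = combine (_⁻¹ G₁ (q x)) (_⁻¹ G₂ (r x))

    assoc : ∀ x y z → mul (mul x y) z ≡ mul x (mul y z)
    assoc x y z = cong₂ combine
      (trans (cong (λ u → _·_ G₁ u (q z)) (qc _ _))
        (trans (G₁.assoc (q x) (q y) (q z)) (cong (_·_ G₁ (q x)) (sym (qc _ _)))))
      (trans (cong (λ u → _·_ G₂ u (r z)) (rc _ _))
        (trans (G₂.assoc (r x) (r y) (r z)) (cong (_·_ G₂ (r x)) (sym (rc _ _)))))

    idˡ : ∀ x → mul e x ≡ x
    idˡ x = trans (cong₂ combine
      (trans (cong (λ u → _·_ G₁ u (q x)) (qc _ _)) (proj₁ G₁.identity (q x)))
      (trans (cong (λ u → _·_ G₂ u (r x)) (rc _ _)) (proj₁ G₂.identity (r x)))) (cqr x)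

    idʳ : ∀ x → mul x e ≡ x
    idʳ x = trans (cong₂ combine
      (trans (cong (_·_ G₁ (q x)) (qc _ _)) (proj₂ G₁.identity (q x)))
      (trans (cong (_·_ G₂ (r x)) (rc _ _)) (proj₂ G₂.identity (r x)))) (cqr x)

    invˡ : ∀ x → mul (inv x) x ≡ e
    invˡ x = cong₂ combine
      (trans (cong (λ u → _·_ G₁ u (q x)) (qc _ _)) (proj₁ G₁.inverse (q x)))
      (trans (cong (λ u → _·_ G₂ u (r x)) (rc _ _)) (proj₁ G₂.inverse (r x)))

    invʳ : ∀ x → mul x (inv x) ≡ e
    invʳ x = cong₂ combine
      (trans (cong (_·_ G₁ (q x)) (qc _ _)) (proj₂ G₁.inverse (q x)))
      (trans (cong (_·_ G₂ (r x)) (rc _ _)) (proj₂ G₂.inverse (r x)))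

  _⊗_ : FinGroup
  _⊗_ = record
    { order = n₁ * n₂
    ; _·_ = mul
    ; ε = e
    ; _⁻¹ = inv
    ; isGroup = record
      { isMonoid = record
        { isSemigroup = record
          { isMagma = record { isEquivalence = isEquivalence ; ∙-cong = cong₂ mul }
          ; assoc = assoc }
        ; identity = idˡ , idʳ }
      ; inverse = invˡ , invʳ
      ; ⁻¹-cong = cong inv }
    }

  _⊠_ : Subset n₁ → Subset n₂ → Subset (n₁ * n₂)
  S₁ ⊠ S₂ = tabulate λ x → lookup S₁ (q x) ∧ lookup S₂ (r x)

-- Covering G₁ by S₁ and G₂ by S₂ and taking products of the covers gives
-- τ(S₁ × S₂) ≤ τ(S₁) τ(S₂), which is the upper bound on κ of the product.
-- For the lower bound, let T cover G₁ × G₂ by S₁ × S₂. For each h ∈ G₂ the first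
-- coordinates of the t ∈ T with h ∈ t₂ S₂ cover G₁ by S₁, so there are at least
-- τ(S₁) such t. Summing over h and counting the pairs (t , h) the other way,
-- |G₂| τ(S₁) ≤ |T| |S₂|, i.e. κ(S₁) ≤ κ(S₁ × S₂); symmetrically for S₂.
module Submission where

open import Defs
open import Algebra.Bundles using (Group)
import Algebra.Properties.Group as GroupProperties
import Algebra.Properties.Semiring.Sum as SemiringSum
open import Data.Bool using (Bool; true; false; _∧_)
open import Data.Bool.Properties using (∧-conicalˡ; ∧-conicalʳ)
open import Data.Fin using (Fin; zero; suc; combine; quotient; remainder; _↑ˡ_; _↑ʳ_)
open import Data.Fin.Properties using (remQuot-combine; combine-remQuot)
open import Data.Fin.Permutation using (Permutation′; permutation)
open import Data.Fin.Subset using (Subset; Nonempty; ∣_∣; _∈_; _∩_; _∪_; ⊥; ⁅_⁆; inside; outside)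
open import Data.Fin.Subset.Properties using (∣⊥∣≡0; ∣⁅x⁆∣≡1; ∣p∣≤∣x∷p∣; x∈⁅x⁆; x∈p∪q⁺; x∈p∩q⁺)
open import Data.Integer as ℤ using (+≤+)
open import Data.Integer.Properties using (pos-*)
open import Data.Nat as ℕ using (ℕ; zero; suc; _+_; _*_; z≤n; s≤s; NonZero)
import Data.Nat.Properties as ℕP
open import Data.Nat.Solver using (module +-*-Solver)
open import Data.Product using (∃; _×_; _,_; proj₁; proj₂)
open import Data.Rational as ℚ using (_/_; toℚᵘ)
import Data.Rational.Properties as ℚP
open import Data.Rational.Unnormalised as ℚᵘ using (mkℚᵘ; *≤*; _≃_)
import Data.Rational.Unnormalised.Properties as ℚᵘP
open import Data.Sum using (inj₁; inj₂)
open import Data.Vec using ([]; _∷_; lookup; tabulate; here; there)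
open import Data.Vec.Properties using (lookup∘tabulate; lookup-zipWith; []=⇒lookup; lookup⇒[]=)
open import Function using (_∘_)
open import Level using (0ℓ)
open import Relation.Binary.PropositionalEquality
open import Algebra.Properties.CommutativeSemigroup ℕP.*-commutativeSemigroup using (interchange)
open SemiringSum ℕP.+-*-semiring
  using (sum; ∑-comm; sum-permute; sum-cong-≗; *-distribˡ-sum; *-distribʳ-sum)

χ : Bool → ℕ
χ true  = 1
χ false = 0

χ-∧ : ∀ a b → χ (a ∧ b) ≡ χ a * χ b
χ-∧ true  b = sym (ℕP.+-identityʳ (χ b))
χ-∧ false b = refl

sum-mono-≤ : ∀ {n} {f g : Fin n → ℕ} → (∀ i → f i ℕ.≤ g i) → sum f ℕ.≤ sum g
sum-mono-≤ {zero}  f≤g = z≤n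
sum-mono-≤ {suc n} f≤g = ℕP.+-mono-≤ (f≤g zero) (sum-mono-≤ (f≤g ∘ suc))

sum-const : ∀ n c → sum {n} (λ _ → c) ≡ n * c
sum-const zero    c = refl
sum-const (suc n) c = cong (c +_) (sum-const n c)

sum-↑ : ∀ m {k} (f : Fin (m + k) → ℕ) → sum f ≡ sum (f ∘ (_↑ˡ k)) + sum (f ∘ (m ↑ʳ_))
sum-↑ zero    f = refl
sum-↑ (suc m) f = trans (cong (f zero +_) (sum-↑ m (f ∘ suc))) (sym (ℕP.+-assoc (f zero) _ _))

sum-combine : ∀ m n (f : Fin (m * n) → ℕ) → sum f ≡ sum (λ a → sum (λ b → f (combine {m} {n} a b)))
sum-combine zero    n f = refl
sum-combine (suc m) n f =
  trans (sum-↑ n f) (cong (sum (f ∘ (_↑ˡ (m * n))) +_) (sum-combine m n (f ∘ (n ↑ʳ_))))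

∣p∣≡∑χ : ∀ {n} (p : Subset n) → ∣ p ∣ ≡ sum (χ ∘ lookup p)
∣p∣≡∑χ []            = refl
∣p∣≡∑χ (inside  ∷ p) = cong suc (∣p∣≡∑χ p)
∣p∣≡∑χ (outside ∷ p) = ∣p∣≡∑χ p

∣tabulate∣≡∑χ : ∀ {n} (f : Fin n → Bool) → ∣ tabulate f ∣ ≡ sum (χ ∘ f)
∣tabulate∣≡∑χ f = trans (∣p∣≡∑χ (tabulate f)) (sum-cong-≗ (cong χ ∘ lookup∘tabulate f))

∣p∩q∣≡∑χ*χ : ∀ {n} (p q : Subset n) → ∣ p ∩ q ∣ ≡ sum (λ i → χ (lookup p i) * χ (lookup q i))
∣p∩q∣≡∑χ*χ p q = trans (∣p∣≡∑χ (p ∩ q))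
  (sum-cong-≗ λ i → trans (cong χ (lookup-zipWith _∧_ i p q)) (χ-∧ (lookup p i) (lookup q i)))

-- Double counting of the pairs (t , h) with t ∈ T and h ∈ A t.
∑∣fibre∣≡∣T∣*c : ∀ {N n} (T : Subset N) (A : Fin N → Subset n) {c} → (∀ t → ∣ A t ∣ ≡ c) →
  sum (λ h → ∣ T ∩ tabulate (λ t → lookup (A t) h) ∣) ≡ ∣ T ∣ * c
∑∣fibre∣≡∣T∣*c T A {c} ∣A∣≡c = begin
  sum (λ h → ∣ T ∩ tabulate (λ t → lookup (A t) h) ∣)
    ≡⟨ sum-cong-≗ (λ h → trans (∣p∩q∣≡∑χ*χ T _) (sum-cong-≗ λ t →
         cong (λ b → χ (lookup T t) * χ b) (lookup∘tabulate (λ t → lookup (A t) h) t))) ⟩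
  sum (λ h → sum (λ t → χ (lookup T t) * χ (lookup (A t) h)))
    ≡⟨ ∑-comm (λ h t → χ (lookup T t) * χ (lookup (A t) h)) ⟩
  sum (λ t → sum (λ h → χ (lookup T t) * χ (lookup (A t) h)))
    ≡⟨ sum-cong-≗ (λ t → sym (*-distribˡ-sum (χ (lookup T t)) (χ ∘ lookup (A t)))) ⟩
  sum (λ t → χ (lookup T t) * sum (χ ∘ lookup (A t)))
    ≡⟨ sum-cong-≗ (λ t → cong (χ (lookup T t) *_) (trans (sym (∣p∣≡∑χ (A t))) (∣A∣≡c t))) ⟩
  sum (λ t → χ (lookup T t) * c)
    ≡⟨ sym (*-distribʳ-sum c (χ ∘ lookup T)) ⟩
  sum (χ ∘ lookup T) * c
    ≡⟨ cong (_* c) (sym (∣p∣≡∑χ T)) ⟩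
  ∣ T ∣ * c ∎
  where open ≡-Reasoning

∈-tabulate⁺ : ∀ {n} {f : Fin n → Bool} {i} → f i ≡ true → i ∈ tabulate f
∈-tabulate⁺ {f = f} {i} fi≡true = lookup⇒[]= i (tabulate f) (trans (lookup∘tabulate f i) fi≡true)

∈-tabulate⁻ : ∀ {n} {f : Fin n → Bool} {i} → i ∈ tabulate f → f i ≡ true
∈-tabulate⁻ {f = f} {i} i∈f = trans (sym (lookup∘tabulate f i)) ([]=⇒lookup i∈f)

∣p∪q∣≤∣p∣+∣q∣ : ∀ {n} (p q : Subset n) → ∣ p ∪ q ∣ ℕ.≤ ∣ p ∣ + ∣ q ∣
∣p∪q∣≤∣p∣+∣q∣ []            []            = z≤n
∣p∪q∣≤∣p∣+∣q∣ (inside  ∷ p) (y       ∷ q) =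
  s≤s (ℕP.≤-trans (∣p∪q∣≤∣p∣+∣q∣ p q) (ℕP.+-monoʳ-≤ ∣ p ∣ (∣p∣≤∣x∷p∣ y q)))
∣p∪q∣≤∣p∣+∣q∣ (outside ∷ p) (inside  ∷ q) =
  ℕP.≤-trans (s≤s (∣p∪q∣≤∣p∣+∣q∣ p q)) (ℕP.≤-reflexive (sym (ℕP.+-suc ∣ p ∣ ∣ q ∣)))
∣p∪q∣≤∣p∣+∣q∣ (outside ∷ p) (outside ∷ q) = ∣p∪q∣≤∣p∣+∣q∣ p q

image : ∀ {m n} → (Fin m → Fin n) → Subset m → Subset n
image f []            = ⊥
image f (inside  ∷ p) = ⁅ f zero ⁆ ∪ image (f ∘ suc) p
image f (outside ∷ p) = image (f ∘ suc) p

∈-image : ∀ {m n} (f : Fin m → Fin n) {p x} → x ∈ p → f x ∈ image f p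
∈-image f {inside  ∷ p} here        = x∈p∪q⁺ (inj₁ (x∈⁅x⁆ (f zero)))
∈-image f {inside  ∷ p} (there x∈p) = x∈p∪q⁺ (inj₂ (∈-image (f ∘ suc) x∈p))
∈-image f {outside ∷ p} (there x∈p) = ∈-image (f ∘ suc) x∈p

∣image∣≤∣p∣ : ∀ {m n} (f : Fin m → Fin n) p → ∣ image f p ∣ ℕ.≤ ∣ p ∣
∣image∣≤∣p∣ {n = n} f [] = ℕP.≤-reflexive (∣⊥∣≡0 n)
∣image∣≤∣p∣ f (inside ∷ p) = begin
  ∣ ⁅ f zero ⁆ ∪ image (f ∘ suc) p ∣     ≤⟨ ∣p∪q∣≤∣p∣+∣q∣ ⁅ f zero ⁆ _ ⟩
  ∣ ⁅ f zero ⁆ ∣ + ∣ image (f ∘ suc) p ∣ ≡⟨ cong (_+ ∣ image (f ∘ suc) p ∣) (∣⁅x⁆∣≡1 (f zero)) ⟩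
  suc ∣ image (f ∘ suc) p ∣             ≤⟨ s≤s (∣image∣≤∣p∣ (f ∘ suc) p) ⟩
  suc ∣ p ∣                             ∎
  where open ℕP.≤-Reasoning
∣image∣≤∣p∣ f (outside ∷ p) = ∣image∣≤∣p∣ (f ∘ suc) p

group : FinGroup → Group 0ℓ 0ℓ
group G = record
  { Carrier = Fin (order G) ; _≈_ = _≡_ ; _∙_ = _·_ G ; ε = ε G ; _⁻¹ = _⁻¹ G ; isGroup = isGroup G }

module LeftTranslation (G : FinGroup) where
  open Group (group G) using (_∙_; _\\_)
  open GroupProperties (group G) using (\\-leftDividesˡ; \\-leftDividesʳ)

  _•_ : Fin (order G) → Subset (order G) → Subset (order G)
  g • S = tabulate (λ h → lookup S (g \\ h))

  ∈-• : ∀ g {S s} → s ∈ S → g ∙ s ∈ g • S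
  ∈-• g {S} s∈S = ∈-tabulate⁺ (trans (cong (lookup S) (\\-leftDividesʳ g _)) ([]=⇒lookup s∈S))

  ∣g•S∣≡∣S∣ : ∀ g S → ∣ g • S ∣ ≡ ∣ S ∣
  ∣g•S∣≡∣S∣ g S = begin
    ∣ g • S ∣                         ≡⟨ ∣tabulate∣≡∑χ (lookup S ∘ (g \\_)) ⟩
    sum (λ h → χ (lookup S (g \\ h))) ≡⟨ sum-permute (χ ∘ lookup S) g\\ ⟨
    sum (χ ∘ lookup S)                ≡⟨ ∣p∣≡∑χ S ⟨
    ∣ S ∣                             ∎
    where
    open ≡-Reasoning
    g\\ : Permutation′ (order G)
    g\\ = permutation (g \\_) (g ∙_) (\\-leftDividesʳ g) (\\-leftDividesˡ g)

record CoversPairs (G H : FinGroup) {N : ℕ} (T : Subset N)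
  (p : Fin N → Fin (order G)) (p′ : Fin N → Fin (order H)) (S : Subset (order G)) (S′ : Subset (order H)) : Set where
  field
    decompose : ∀ a b → ∃ λ t → ∃ λ u → ∃ λ v →
      t ∈ T × u ∈ S × v ∈ S′ × a ≡ _·_ G (p t) u × b ≡ _·_ H (p′ t) v

open CoversPairs

coversPairs-swap : ∀ {G H N T p p′ S S′} → CoversPairs G H {N} T p p′ S S′ → CoversPairs H G T p′ p S′ S
coversPairs-swap cov .decompose b a with cov .decompose a b
... | t , u , v , t∈T , u∈S , v∈S′ , a≡tu , b≡tv = t , v , u , t∈T , v∈S′ , u∈S , b≡tv , a≡tu

module _ {G H : FinGroup} {N} {T : Subset N} {p p′ S S′} (cov : CoversPairs G H T p p′ S S′) where
  open LeftTranslation H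

  fibre : Fin (order H) → Subset N
  fibre h = T ∩ tabulate (λ t → lookup (p′ t • S′) h)

  image-fibre-covers : ∀ h → Covers G (image p (fibre h)) S
  image-fibre-covers h a with cov .decompose a h
  ... | t , u , v , t∈T , u∈S , v∈S′ , a≡tu , refl =
    p t , u , ∈-image p (x∈p∩q⁺ (t∈T , ∈-tabulate⁺ ([]=⇒lookup (∈-• (p′ t) v∈S′)))) , u∈S , a≡tu

  order*τ≤∣T∣*∣S′∣ : ∀ {τ} → (∀ T′ → Covers G T′ S → τ ℕ.≤ ∣ T′ ∣) →
    order H * τ ℕ.≤ ∣ T ∣ * ∣ S′ ∣
  order*τ≤∣T∣*∣S′∣ {τ} τ-minimal = begin
    order H * τ             ≡⟨ sum-const (order H) τ ⟨
    sum {order H} (λ _ → τ) ≤⟨ sum-mono-≤ {g = λ h → ∣ fibre h ∣} τ≤∣fibre∣ ⟩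
    sum (λ h → ∣ fibre h ∣) ≡⟨ ∑∣fibre∣≡∣T∣*c T (λ t → p′ t • S′) (λ t → ∣g•S∣≡∣S∣ (p′ t) S′) ⟩
    ∣ T ∣ * ∣ S′ ∣           ∎
    where
    open ℕP.≤-Reasoning
    τ≤∣fibre∣ : ∀ h → τ ℕ.≤ ∣ fibre h ∣
    τ≤∣fibre∣ h = ℕP.≤-trans (τ-minimal _ (image-fibre-covers h)) (∣image∣≤∣p∣ p (fibre h))

module _ (G₁ G₂ : FinGroup) where
  private
    n₁ = order G₁
    n₂ = order G₂
    q : Fin (n₁ * n₂) → Fin n₁
    q = quotient {n₁} n₂
    r : Fin (n₁ * n₂) → Fin n₂
    r = remainder {n₁} n₂
    q-combine : ∀ a b → q (combine a b) ≡ a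
    q-combine a b = cong proj₁ (remQuot-combine {n₁} {n₂} a b)
    r-combine : ∀ a b → r (combine a b) ≡ b
    r-combine a b = cong proj₂ (remQuot-combine {n₁} {n₂} a b)

  combine-· : ∀ a b c d →
    _·_ (G₁ ⊗ G₂) (combine a b) (combine c d) ≡ combine (_·_ G₁ a c) (_·_ G₂ b d)
  combine-· a b c d = cong₂ combine
    (cong₂ (_·_ G₁) (q-combine a b) (q-combine c d)) (cong₂ (_·_ G₂) (r-combine a b) (r-combine c d))

  ∈-⊠⁺ : ∀ {S₁ S₂ a b} → a ∈ S₁ → b ∈ S₂ → combine a b ∈ _⊠_ G₁ G₂ S₁ S₂
  ∈-⊠⁺ {S₁} {S₂} {a} {b} a∈S₁ b∈S₂ = ∈-tabulate⁺ (cong₂ _∧_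
    (trans (cong (lookup S₁) (q-combine a b)) ([]=⇒lookup a∈S₁))
    (trans (cong (lookup S₂) (r-combine a b)) ([]=⇒lookup b∈S₂)))

  ∈-⊠⁻ : ∀ {S₁ S₂ x} → x ∈ _⊠_ G₁ G₂ S₁ S₂ → q x ∈ S₁ × r x ∈ S₂
  ∈-⊠⁻ {S₁} {S₂} {x} x∈S = let both = ∈-tabulate⁻ x∈S in
    lookup⇒[]= (q x) S₁ (∧-conicalˡ _ _ both) , lookup⇒[]= (r x) S₂ (∧-conicalʳ _ _ both)

  ∣S₁⊠S₂∣≡∣S₁∣*∣S₂∣ : ∀ S₁ S₂ → ∣ _⊠_ G₁ G₂ S₁ S₂ ∣ ≡ ∣ S₁ ∣ * ∣ S₂ ∣
  ∣S₁⊠S₂∣≡∣S₁∣*∣S₂∣ S₁ S₂ = begin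
    ∣ _⊠_ G₁ G₂ S₁ S₂ ∣
      ≡⟨ ∣tabulate∣≡∑χ (λ x → lookup S₁ (q x) ∧ lookup S₂ (r x)) ⟩
    sum (λ x → χ (lookup S₁ (q x) ∧ lookup S₂ (r x)))
      ≡⟨ sum-combine n₁ n₂ (λ x → χ (lookup S₁ (q x) ∧ lookup S₂ (r x))) ⟩
    sum (λ a → sum (λ b → χ (lookup S₁ (q (combine {n₁} {n₂} a b)) ∧ lookup S₂ (r (combine a b)))))
      ≡⟨ sum-cong-≗ (λ a → sum-cong-≗ λ b → trans
           (cong₂ (λ a′ b′ → χ (lookup S₁ a′ ∧ lookup S₂ b′)) (q-combine a b) (r-combine a b))
           (χ-∧ (lookup S₁ a) (lookup S₂ b))) ⟩
    sum (λ a → sum (λ b → χ (lookup S₁ a) * χ (lookup S₂ b)))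
      ≡⟨ sum-cong-≗ (λ a → sym (*-distribˡ-sum (χ (lookup S₁ a)) (χ ∘ lookup S₂))) ⟩
    sum (λ a → χ (lookup S₁ a) * sum (χ ∘ lookup S₂))
      ≡⟨ sym (*-distribʳ-sum (sum (χ ∘ lookup S₂)) (χ ∘ lookup S₁)) ⟩
    sum (χ ∘ lookup S₁) * sum (χ ∘ lookup S₂)
      ≡⟨ sym (cong₂ _*_ (∣p∣≡∑χ S₁) (∣p∣≡∑χ S₂)) ⟩
    ∣ S₁ ∣ * ∣ S₂ ∣ ∎
    where open ≡-Reasoning

  ⊠-covers : ∀ {S₁ T₁ S₂ T₂} → Covers G₁ T₁ S₁ → Covers G₂ T₂ S₂ →
    Covers (G₁ ⊗ G₂) (_⊠_ G₁ G₂ T₁ T₂) (_⊠_ G₁ G₂ S₁ S₂)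
  ⊠-covers cov₁ cov₂ g with cov₁ (q g) | cov₂ (r g)
  ... | t₁ , s₁ , t₁∈T₁ , s₁∈S₁ , qg≡t₁s₁ | t₂ , s₂ , t₂∈T₂ , s₂∈S₂ , rg≡t₂s₂ =
    combine t₁ t₂ , combine s₁ s₂ , ∈-⊠⁺ t₁∈T₁ t₂∈T₂ , ∈-⊠⁺ s₁∈S₁ s₂∈S₂ ,
    trans (sym (combine-remQuot {n₁} n₂ g))
      (trans (cong₂ combine qg≡t₁s₁ rg≡t₂s₂) (sym (combine-· t₁ t₂ s₁ s₂)))

  covers⇒coversPairs : ∀ {T S₁ S₂} → Covers (G₁ ⊗ G₂) T (_⊠_ G₁ G₂ S₁ S₂) →
    CoversPairs G₁ G₂ T q r S₁ S₂
  covers⇒coversPairs {S₁ = S₁} {S₂} cov .decompose a b with cov (combine a b)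
  ... | t , s , t∈T , s∈S , ab≡ts =
    t , q s , r s , t∈T , proj₁ (∈-⊠⁻ {S₁} {S₂} s∈S) , proj₂ (∈-⊠⁻ {S₁} {S₂} s∈S) ,
    trans (sym (q-combine a b)) (trans (cong q ab≡ts) (q-combine _ _)) ,
    trans (sym (r-combine a b)) (trans (cong r ab≡ts) (r-combine _ _))

  τ-⊗≤τ*τ : ∀ {S₁ S₂ τ₁ τ₂ τ₁₂} → IsTau G₁ S₁ τ₁ → IsTau G₂ S₂ τ₂ →
    IsTau (G₁ ⊗ G₂) (_⊠_ G₁ G₂ S₁ S₂) τ₁₂ → τ₁₂ ℕ.≤ τ₁ * τ₂
  τ-⊗≤τ*τ {S₁} {S₂} ((T₁ , cov₁ , refl) , _) ((T₂ , cov₂ , refl) , _) (_ , τ₁₂-minimal) = ℕP.≤-trans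
    (τ₁₂-minimal _ (⊠-covers {S₁} {T₁} {S₂} {T₂} cov₁ cov₂)) (ℕP.≤-reflexive (∣S₁⊠S₂∣≡∣S₁∣*∣S₂∣ T₁ T₂))

toℚᵘ-/ : ∀ i d → toℚᵘ (i / suc d) ≃ mkℚᵘ i d
toℚᵘ-/ i d = ℚP.toℚᵘ-fromℚᵘ (mkℚᵘ i d)

/-≤-/ : ∀ a b c d .{{_ : NonZero c}} .{{_ : NonZero d}} → a * d ℕ.≤ b * c → ℤ.+ a / c ℚ.≤ ℤ.+ b / d
/-≤-/ a b (suc c) (suc d) ad≤bc = ℚP.toℚᵘ-cancel-≤
  (ℚᵘP.≤-respˡ-≃ (ℚᵘP.≃-sym (toℚᵘ-/ (ℤ.+ a) c)) (ℚᵘP.≤-respʳ-≃ (ℚᵘP.≃-sym (toℚᵘ-/ (ℤ.+ b) d))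
    (*≤* (subst₂ ℤ._≤_ (pos-* a (suc d)) (pos-* b (suc c)) (+≤+ ad≤bc)))))

/-monoˡ-≤ : ∀ {a b} c .{{_ : NonZero c}} → a ℕ.≤ b → ℤ.+ a / c ℚ.≤ ℤ.+ b / c
/-monoˡ-≤ {a} {b} c a≤b = /-≤-/ a b c c (ℕP.*-monoˡ-≤ c a≤b)

/-*-/ : ∀ a b c d .{{_ : NonZero c}} .{{_ : NonZero d}} →
  (ℤ.+ a / c) ℚ.* (ℤ.+ b / d) ≡ (ℤ.+ (a * b) / (c * d)) {{ℕP.m*n≢0 c d}}
/-*-/ a b (suc c) (suc d) = ℚP.toℚᵘ-injective (begin
  toℚᵘ ((ℤ.+ a / suc c) ℚ.* (ℤ.+ b / suc d))     ≈⟨ ℚP.toℚᵘ-homo-* (ℤ.+ a / suc c) (ℤ.+ b / suc d) ⟩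
  toℚᵘ (ℤ.+ a / suc c) ℚᵘ.* toℚᵘ (ℤ.+ b / suc d) ≈⟨ ℚᵘP.*-cong (toℚᵘ-/ (ℤ.+ a) c) (toℚᵘ-/ (ℤ.+ b) d) ⟩
  mkℚᵘ (ℤ.+ a ℤ.* ℤ.+ b) _                       ≡⟨ cong (λ i → mkℚᵘ i _) (sym (pos-* a b)) ⟩
  mkℚᵘ (ℤ.+ (a * b)) _                           ≈⟨ toℚᵘ-/ (ℤ.+ (a * b)) _ ⟨
  toℚᵘ (ℤ.+ (a * b) / (suc c * suc d))           ∎)
  where open ℚᵘP.≃-Reasoning

/-≤-/-rescale : ∀ x y k s m n {P N} .{{_ : NonZero m}} .{{_ : NonZero N}} →
  m * n ≡ N → k * s ≡ P → n * x ℕ.≤ y * s → ℤ.+ (x * k) / m ℚ.≤ ℤ.+ (y * P) / N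
/-≤-/-rescale x y k s m n refl refl nx≤ys = /-≤-/ (x * k) (y * (k * s)) m (m * n)
  (subst₂ ℕ._≤_ (solve 6 (λ x y k s m n → (n :* x) :* (k :* m) := (x :* k) :* (m :* n)) refl x y k s m n)
                (solve 6 (λ x y k s m n → (y :* s) :* (k :* m) := (y :* (k :* s)) :* m) refl x y k s m n)
                (ℕP.*-monoˡ-≤ (k * m) nx≤ys))
  where open +-*-Solver

lemma3p6 : (G₁ G₂ : FinGroup) (S₁ : Subset (order G₁)) (S₂ : Subset (order G₂))
    → Nonempty S₁ → Nonempty S₂
    → (τ₁ τ₂ τ₁₂ : ℕ)
    → IsTau G₁ S₁ τ₁ → IsTau G₂ S₂ τ₂ → IsTau (G₁ ⊗ G₂) (_⊠_ G₁ G₂ S₁ S₂) τ₁₂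
    → (κ (G₁ ⊗ G₂) (_⊠_ G₁ G₂ S₁ S₂) τ₁₂ ℚ.≤ κ G₁ S₁ τ₁ ℚ.* κ G₂ S₂ τ₂)
      × (κ G₁ S₁ τ₁ ℚ.⊔ κ G₂ S₂ τ₂ ℚ.≤ κ (G₁ ⊗ G₂) (_⊠_ G₁ G₂ S₁ S₂) τ₁₂)
lemma3p6 G₁ G₂ S₁ S₂ _ _ τ₁ τ₂ τ₁₂ isTau₁ isTau₂ isTau₁₂@((T , cov , refl) , _) =
  κ-⊗≤κ*κ , ℚP.⊔-lub κ₁≤κ-⊗ κ₂≤κ-⊗
  where
  instance
    n₁≢0 : NonZero (order G₁)
    n₁≢0 = order-nonZero G₁
    n₂≢0 : NonZero (order G₂)
    n₂≢0 = order-nonZero G₂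
    n₁n₂≢0 : NonZero (order (G₁ ⊗ G₂))
    n₁n₂≢0 = order-nonZero (G₁ ⊗ G₂)

  S₁⊠S₂ : Subset (order (G₁ ⊗ G₂))
  S₁⊠S₂ = _⊠_ G₁ G₂ S₁ S₂

  ∣S₁⊠S₂∣ : ∣ S₁⊠S₂ ∣ ≡ ∣ S₁ ∣ * ∣ S₂ ∣
  ∣S₁⊠S₂∣ = ∣S₁⊠S₂∣≡∣S₁∣*∣S₂∣ G₁ G₂ S₁ S₂

  cov₁₂ : CoversPairs G₁ G₂ T (quotient (order G₂)) (remainder {order G₁} (order G₂)) S₁ S₂
  cov₁₂ = covers⇒coversPairs G₁ G₂ {S₁ = S₁} {S₂ = S₂} cov

  κ-⊗≤κ*κ : κ (G₁ ⊗ G₂) S₁⊠S₂ τ₁₂ ℚ.≤ κ G₁ S₁ τ₁ ℚ.* κ G₂ S₂ τ₂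
  κ-⊗≤κ*κ = subst (κ (G₁ ⊗ G₂) S₁⊠S₂ τ₁₂ ℚ.≤_)
    (sym (/-*-/ (τ₁ * ∣ S₁ ∣) (τ₂ * ∣ S₂ ∣) (order G₁) (order G₂)))
    (/-monoˡ-≤ (order G₁ * order G₂) (begin
      τ₁₂ * ∣ S₁⊠S₂ ∣             ≡⟨ cong (τ₁₂ *_) ∣S₁⊠S₂∣ ⟩
      τ₁₂ * (∣ S₁ ∣ * ∣ S₂ ∣)       ≤⟨ ℕP.*-monoˡ-≤ _ (τ-⊗≤τ*τ G₁ G₂ {S₁} {S₂} isTau₁ isTau₂ isTau₁₂) ⟩
      τ₁ * τ₂ * (∣ S₁ ∣ * ∣ S₂ ∣)   ≡⟨ interchange τ₁ τ₂ ∣ S₁ ∣ ∣ S₂ ∣ ⟩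
      τ₁ * ∣ S₁ ∣ * (τ₂ * ∣ S₂ ∣)   ∎))
    where open ℕP.≤-Reasoning

  κ₁≤κ-⊗ : κ G₁ S₁ τ₁ ℚ.≤ κ (G₁ ⊗ G₂) S₁⊠S₂ τ₁₂
  κ₁≤κ-⊗ = /-≤-/-rescale τ₁ τ₁₂ ∣ S₁ ∣ ∣ S₂ ∣ (order G₁) (order G₂) refl (sym ∣S₁⊠S₂∣)
    (order*τ≤∣T∣*∣S′∣ cov₁₂ (proj₂ isTau₁))

  κ₂≤κ-⊗ : κ G₂ S₂ τ₂ ℚ.≤ κ (G₁ ⊗ G₂) S₁⊠S₂ τ₁₂
  κ₂≤κ-⊗ = /-≤-/-rescale τ₂ τ₁₂ ∣ S₂ ∣ ∣ S₁ ∣ (order G₂) (order G₁)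
    (ℕP.*-comm (order G₂) (order G₁)) (trans (ℕP.*-comm ∣ S₂ ∣ ∣ S₁ ∣) (sym ∣S₁⊠S₂∣))
    (order*τ≤∣T∣*∣S′∣ (coversPairs-swap cov₁₂) (proj₂ isTau₂))
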